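{- Let $F$ be rule $234$ on the square grid, let $x\in\{0,1\}^{\{0,\dots,n-1\}^2}$ be a finite configuration, $c=c(x)$, and $u\in\{0,\dots,n-1\}^2$. Then $u$ is stable for $c$ if and only if there exists a set $S\subseteq\{0,\dots,n-1\}^2$ such that $u\in S$, $x_w=0$ for every $w\in S$, and the graph $G[S]$ has minimum degree at least $3$.
   Context: Square grid with von Neumann neighborhood: the neighbors $N(u)$ of $u\in\mathbb{Z}^2$ are the four cells at Manhattan distance 1. Rule $234$ is the synchronous map on configurations $c\in\{0,1\}^{\mathbb{Z}^2}$ given by $F(c)_u=1$ if $c_u=1$ or $\sum_{v\in N(u)}c_v\in\{2,3,4\}$, and $F(c)_u=0$ otherwise (1 = active, 0 = inactive). For $x:\{0,\dots,n-1\}^2\to\{0,1\}$, $c(x)$ is the periodic configuration $c(x)_{(i,j)}=x_{(i\bmod n,\,j\bmod n)}$; equivalently the dynamics is on the torus $(\mathbb{Z}/n\mathbb{Z})^2$. A cell $u$ with $c_u=0$ is stable for $c$ if $F^t(c)_u=0$ for all $t\ge0$. For a set of sites $S$, $G[S]$ is the graph with vertex set $S$ in which two sites are adjacent if they are von Neumann neighbors on the torus $(\mathbb{Z}/n\mathbb{Z})^2$. -}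

module Defs where

open import Data.Nat using (ℕ; zero; suc; _+_; _≤_)
open import Data.Fin using (Fin; zero; suc; toℕ)
open import Data.Bool using (Bool; true; false; _∨_)
open import Data.Product using (_×_; _,_)
open import Data.List using (List; _∷_; []; map)
open import Data.Nat.ListAction using (sum)
open import Relation.Nullary.Decidable using (⌊_⌋)
open import Data.Nat using (_≤?_)
open import Relation.Binary.PropositionalEquality using (_≡_)
import Data.Nat.DivMod

-- Cells of the torus (Z/nZ)^2, represented by {0,..,n-1}^2.
Cell : ℕ → Set
Cell n = Fin n × Fin n

-- A finite configuration x : {0,..,n-1}^2 → {0,1}  (true = 1 = active).
Config : ℕ → Set
Config n = Cell n → Bool

sucMod : ∀ {n} → Fin n → Fin n
sucMod {suc n} i = Data.Nat.DivMod._mod_ (suc (toℕ i)) (suc n)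

predMod : ∀ {n} → Fin n → Fin n
predMod {suc n} zero = Data.Fin.fromℕ n
predMod {suc n} (suc i) = Data.Fin.inject₁ i

-- The four von Neumann neighbour positions of (i , j), listed with
-- multiplicity (as in the periodic configuration on Z^2).
neighbours : ∀ {n} → Cell n → List (Cell n)
neighbours (i , j) = (sucMod i , j) ∷ (predMod i , j) ∷ (i , sucMod j) ∷ (i , predMod j) ∷ []

boolToℕ : Bool → ℕ
boolToℕ true = 1
boolToℕ false = 0

countN : ∀ {n} → (Cell n → Bool) → Cell n → ℕ
countN c u = sum (map (λ v → boolToℕ (c v)) (neighbours u))

-- Rule 234: F(c)_u = 1 iff c_u = 1 or the number of active neighbours is in {2,3,4}.
-- (There are exactly 4 neighbours, so this is: count ≥ 2.)
rule234 : ∀ {n} → Config n → Config n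
rule234 c u = c u ∨ ⌊ 2 ≤? countN c u ⌋

iterate : ∀ {A : Set} → (A → A) → ℕ → A → A
iterate f zero a = a
iterate f (suc t) a = f (iterate f t a)

Stable : ∀ {n} → Config n → Cell n → Set
Stable x u = (t : ℕ) → iterate rule234 t x u ≡ false

-- S ⊆ {0..n-1}^2 as a (decidable) predicate; degree of w in G[S]
-- = number of von Neumann neighbours of w on the torus lying in S.
Subset² : ℕ → Set
Subset² n = Cell n → Bool

degIn : ∀ {n} → Subset² n → Cell n → ℕ
degIn S w = countN S w

-- Rule 234 is inflationary (active cells stay active), and a cell stays
-- inactive for one step iff it is inactive with at most one active neighbour.
-- Since every cell has four neighbour slots, "at most one active neighbour"
-- is the same as "at least three inactive neighbours".
--
--  * (⇐) Such an S is a trap: by induction on time, every cell of S has at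
--    most one neighbour outside S, and those inside S are still inactive.
--  * (⇒) Measured by its number of active cells, an inflationary orbit on a
--    finite set can only grow finitely often, so it reaches a fixed point d.
--    The inactive cells of d form the required S: it contains the stable
--    cell u, lies inside the inactive cells of x, and each of its cells,
--    being fixed and inactive, has at least three inactive neighbours.
module Submission where

open import Defs
open import Data.Nat using (ℕ; zero; suc; _+_; _≤_; z≤n; s≤s; s≤s⁻¹; _≤?_)
open import Data.Nat.Properties
  using (≤-trans; ≤-reflexive; ≰⇒>; ≤-<-trans; n≤1+n; +-suc; suc-injective; +-monoˡ-≤; +-cancelˡ-≤; m≤n⇒m<n∨m≡n; n≮n)
open import Data.Nat.ListAction using (sum)
open import Data.Bool using (Bool; true; false; not)
open import Data.Bool.Properties using (not-involutive)
open import Data.List using (List; []; _∷_; map; length; allFin; cartesianProduct)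
open import Data.List.Relation.Unary.Any using (here; there)
open import Data.List.Membership.Propositional using (_∈_)
open import Data.List.Membership.Propositional.Properties using (∈-allFin; ∈-cartesianProduct⁺)
open import Data.Product using (Σ; _×_; _,_; proj₁; proj₂)
open import Data.Sum using (inj₁; inj₂; _⊎_)
open import Data.Empty using (⊥-elim)
open import Function using (_∘_)
open import Function.Bundles using (_⇔_; mk⇔)
open import Relation.Nullary using (yes; no)
open import Relation.Binary.PropositionalEquality using (_≡_; refl; sym; trans; cong)

_⊆_ : {A : Set} → (A → Bool) → (A → Bool) → Set
c ⊆ d = ∀ a → c a ≡ true → d a ≡ true

⊆-false : {A : Set} {c d : A → Bool} → c ⊆ d → ∀ a → d a ≡ false → c a ≡ false
⊆-false {c = c} c⊆d a da≡false with c a in ca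
... | false = refl
... | true  with trans (sym (c⊆d a ca)) da≡false
...   | ()

disjoint⇒⊆complement : {A : Set} {c S : A → Bool} →
  (∀ a → S a ≡ true → c a ≡ false) → c ⊆ (not ∘ S)
disjoint⇒⊆complement {S = S} disjoint a ca with S a in Sa
... | false = refl
... | true  with trans (sym ca) (disjoint a Sa)
...   | ()

-- Number of entries of the list l at which c is true (with multiplicity);
-- countN c w is by definition  weight c (neighbours w).
weight : {A : Set} → (A → Bool) → List A → ℕ
weight c l = sum (map (λ v → boolToℕ (c v)) l)

weight-bound : {A : Set} (c : A → Bool) (l : List A) → weight c l ≤ length l
weight-bound c []      = z≤n
weight-bound c (v ∷ l) with c v
... | true  = s≤s (weight-bound c l)
... | false = ≤-trans (weight-bound c l) (n≤1+n (length l))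

weight-complement : {A : Set} (c : A → Bool) (l : List A) →
  weight c l + weight (not ∘ c) l ≡ length l
weight-complement c []      = refl
weight-complement c (v ∷ l) with c v
... | true  = cong suc (weight-complement c l)
... | false = trans (+-suc (weight c l) _) (cong suc (weight-complement c l))

weight-mono : {A : Set} {c d : A → Bool} → c ⊆ d → (l : List A) → weight c l ≤ weight d l
weight-mono c⊆d []      = z≤n
weight-mono {c = c} {d} c⊆d (v ∷ l) with c v in cv | d v in dv
... | true  | true  = s≤s (weight-mono c⊆d l)
... | false | true  = ≤-trans (weight-mono c⊆d l) (n≤1+n _)
... | false | false = weight-mono c⊆d l
... | true  | false with trans (sym (c⊆d v cv)) dv
...   | ()

weight-≡⇒agree : {A : Set} {c d : A → Bool} → c ⊆ d → (l : List A) →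
  weight c l ≡ weight d l → ∀ {a} → a ∈ l → c a ≡ d a
weight-≡⇒agree {c = c} {d} c⊆d (v ∷ l) eq a∈l with c v in cv | d v in dv
... | true  | false with trans (sym (c⊆d v cv)) dv
...   | ()
weight-≡⇒agree c⊆d (v ∷ l) eq (here refl)   | true  | true  = trans cv (sym dv)
weight-≡⇒agree c⊆d (v ∷ l) eq (there a∈l)   | true  | true  =
  weight-≡⇒agree c⊆d l (suc-injective eq) a∈l
weight-≡⇒agree c⊆d (v ∷ l) eq (here refl)   | false | false = trans cv (sym dv)
weight-≡⇒agree c⊆d (v ∷ l) eq (there a∈l)   | false | false = weight-≡⇒agree c⊆d l eq a∈l
weight-≡⇒agree c⊆d (v ∷ l) eq a∈l           | false | true  =
  ⊥-elim (n≮n _ (≤-trans (s≤s (weight-mono c⊆d l)) (≤-reflexive (sym eq))))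

Fixed : {A : Set} → ((A → Bool) → (A → Bool)) → (A → Bool) → Set
Fixed f d = ∀ a → f d a ≡ d a

iterate-inflationary : {A : Set} (f : (A → Bool) → (A → Bool)) → (∀ c → c ⊆ f c) →
  ∀ t c → c ⊆ iterate f t c
iterate-inflationary f infl zero    c a ca = ca
iterate-inflationary f infl (suc t) c a ca =
  infl (iterate f t c) a (iterate-inflationary f infl t c a ca)

-- On a type enumerated by the list es, the orbit of an inflationary map
-- reaches a fixed point: each non-fixed step raises the weight, which is
-- bounded by the length of es.
module Stabilisation {A : Set} (es : List A) (complete : ∀ a → a ∈ es)
                     (f : (A → Bool) → (A → Bool)) (inflationary : ∀ c → c ⊆ f c) where

  -- Before time t either a fixed point was met, or every step so far was strict.
  progress : ∀ c t → Σ ℕ (λ s → Fixed f (iterate f s c)) ⊎ t ≤ weight (iterate f t c) es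
  progress c zero = inj₂ z≤n
  progress c (suc t) with progress c t
  ... | inj₁ fixed = inj₁ fixed
  ... | inj₂ t≤weight with m≤n⇒m<n∨m≡n (weight-mono (inflationary (iterate f t c)) es)
  ...   | inj₁ grows = inj₂ (≤-<-trans t≤weight grows)
  ...   | inj₂ same  = inj₁ (t , λ a →
            sym (weight-≡⇒agree (inflationary (iterate f t c)) es same (complete a)))

  stabilises : ∀ c → Σ ℕ (λ s → Fixed f (iterate f s c))
  stabilises c with progress c (suc (length es))
  ... | inj₁ fixed   = fixed
  ... | inj₂ tooMany = ⊥-elim (n≮n _ (≤-trans tooMany (weight-bound _ es)))

cells : (n : ℕ) → List (Cell n)
cells n = cartesianProduct (allFin n) (allFin n)

∈-cells : ∀ {n} (w : Cell n) → w ∈ cells n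
∈-cells (i , j) = ∈-cartesianProduct⁺ (∈-allFin i) (∈-allFin j)

rule234-inflationary : ∀ {n} (c : Config n) → c ⊆ rule234 c
rule234-inflationary c w cw rewrite cw = refl

rule234-inactive⇒few : ∀ {n} (c : Config n) w → rule234 c w ≡ false → countN c w ≤ 1
rule234-inactive⇒few c w off with c w | 2 ≤? countN c w
... | false | no  ¬2≤count = s≤s⁻¹ (≰⇒> ¬2≤count)
... | false | yes _ with off
...   | ()
rule234-inactive⇒few c w () | true | _

few⇒rule234-inactive : ∀ {n} (c : Config n) w → c w ≡ false → countN c w ≤ 1 →
  rule234 c w ≡ false
few⇒rule234-inactive c w cw few rewrite cw with 2 ≤? countN c w
... | no  _       = refl
... | yes 2≤count with ≤-trans 2≤count few
...   | s≤s ()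

-- Every cell has four neighbour slots, so a predicate c and its complement
-- share them: few in c means many outside c, and vice versa.
few⇒many-outside : ∀ {n} (c : Cell n → Bool) w → countN c w ≤ 1 → 3 ≤ countN (not ∘ c) w
few⇒many-outside c w few =
  s≤s⁻¹ (≤-trans (≤-reflexive (sym (weight-complement c (neighbours w))))
                 (+-monoˡ-≤ (countN (not ∘ c) w) few))

many⇒few-outside : ∀ {n} (c : Cell n → Bool) w → 3 ≤ countN c w → countN (not ∘ c) w ≤ 1
many⇒few-outside c w many =
  +-cancelˡ-≤ 3 _ _ (≤-trans (+-monoˡ-≤ (countN (not ∘ c) w) many)
                             (≤-reflexive (weight-complement c (neighbours w))))

Trap : ∀ {n} → Config n → Subset² n → Set
Trap {n} x S = ((w : Cell n) → S w ≡ true → x w ≡ false) ×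
               ((w : Cell n) → S w ≡ true → 3 ≤ degIn S w)

-- A trap stays inactive forever: each of its cells has at most one neighbour
-- outside S, and the neighbours inside S are inactive by induction.
trap-stays-inactive : ∀ {n} (x : Config n) (S : Subset² n) → Trap x S →
  ∀ t w → S w ≡ true → iterate rule234 t x w ≡ false
trap-stays-inactive x S (inactive , degree) zero    w Sw = inactive w Sw
trap-stays-inactive x S trap@(inactive , degree) (suc t) w Sw =
  few⇒rule234-inactive now w (trap-stays-inactive x S trap t w Sw)
    (≤-trans (weight-mono now⊆outside (neighbours w)) (many⇒few-outside S w (degree w Sw)))
  where
  now : Config _
  now = iterate rule234 t x
  now⊆outside : now ⊆ (not ∘ S)
  now⊆outside = disjoint⇒⊆complement (trap-stays-inactive x S trap t)

-- The inactive cells of the fixed point reached from x form a trap containing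
-- every stable cell.
stable⇒trap : ∀ {n} (x : Config n) u → Stable x u → Σ (Subset² n) (λ S → S u ≡ true × Trap x S)
stable⇒trap {n} x u stable = not ∘ final , cong not (stable s) , inactive , degree
  where
  open Stabilisation (cells n) ∈-cells rule234 rule234-inflationary
  s : ℕ
  s = proj₁ (stabilises x)
  final : Config n
  final = iterate rule234 s x
  off : ∀ w → not (final w) ≡ true → final w ≡ false
  off w e = trans (sym (not-involutive _)) (cong not e)
  inactive : ∀ w → not (final w) ≡ true → x w ≡ false
  inactive w e = ⊆-false (iterate-inflationary rule234 rule234-inflationary s x) w (off w e)
  degree : ∀ w → not (final w) ≡ true → 3 ≤ degIn (not ∘ final) w
  degree w e = few⇒many-outside final w
                 (rule234-inactive⇒few final w (trans (proj₂ (stabilises x) w) (off w e)))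

lemma3 : (n : ℕ) (x : Config n) (u : Cell n) →
    Stable x u ⇔
      Σ (Subset² n) (λ S →
        (S u ≡ true) ×
        ((w : Cell n) → S w ≡ true → x w ≡ false) ×
        ((w : Cell n) → S w ≡ true → 3 ≤ degIn S w))
lemma3 n x u = mk⇔ (stable⇒trap x u)
  (λ (S , Su , trap) t → trap-stays-inactive x S trap t u Su)
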